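{- Let $x$ be a complex number with $x\neq0$, $x^2\neq 1$, $2x^2\neq 1$; fix a square root $\sqrt{x^2-1}$ and put $\omega(x)=x+\sqrt{x^2-1}$. Then for every integer $n\geq1$: \begin{gather*} \sum_{k=1}^n{n\choose k}\frac{U_{k-1}(x)}{\big(\sqrt{x^2-1}\big)^{k-1}}\bigl(1+(-1)^{n-k}\bigr) = \sum_{k=0}^n{n\choose k}\frac{T_{k}(x)}{\big(\sqrt{x^2-1}\big)^k}\bigl(1-(-1)^{n-k}\bigr),\\ \sum_{k=0}^n{n\choose k}\frac{U_{2k}(x)}{\big(2x\sqrt{x^2-1}\big)^{k-1}}\bigl(\omega(x)+(-1)^{n-k}\omega^{ -1}(x)\bigr)=2x\sum_{k=0}^n{n\choose k}\frac{T_{2k+1}(x)}{\big(2x\sqrt{x^2-1}\big)^k}\bigl(\omega(x)-(-1)^{n-k}\omega^{ -1}(x)\bigr),\\ \sqrt{x^2-1}\sum_{k=1}^n{n\choose k}\frac{U_{2k-1}(x)}{\big(2x\sqrt{x^2-1}\big)^{k}}\bigl(1+(-1)^{n-k}\bigr)=\sum_{k=0}^n{n\choose k}\frac{T_{2k}(x)}{\big(2x\sqrt{x^2-1}\big)^k}\bigl(1-(-1)^{n-k}\bigr),\\ \sum_{k=1}^n{n\choose k}U_{k-1}(x)\left(\frac{2x^2-1}{2x^2\sqrt{x^2-1}}\right)^{k-1}\bigl(\omega(x)+(-1)^{n-k}\omega^{ -1}(x)\bigr)\\ =\left(\frac{2x^2-1}{2x^2}\right)^{n-1}\sum_{k=0}^n{n\choose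 k} T_{2k+1}(x)\left(\frac{x}{(2x^2-1)\sqrt{x^2-1}}\right)^k\bigl(1-(-1)^{n-k}\bigr),\\ \sum_{k=1}^n{n\choose k}U_{k-1}(x)\left(\frac{2x^2-1}{2x^2\sqrt{x^2-1}}\right)^{k-1}\bigl(1+(-1)^{n-k}\bigr)\\ =\left(\frac{2x^2-1}{2x^2}\right)^{n-1}\sum_{k=0}^n{n\choose k} T_{2k}(x)\left(\frac{x}{(2x^2-1)\sqrt{x^2-1}}\right)^k\bigl(1-(-1)^{n-k}\bigr),\\ \sqrt{x^2-1}\sum_{k=0}^n{n\choose k}U_{2k}(x)\left(\frac{x}{(2x^2-1)\sqrt{x^2-1}}\right)^{k}\bigl(1+(-1)^{n-k}\bigr)\\ =\left(\frac{2x^2}{2x^2-1}\right)^{n}\sum_{k=0}^n{n\choose k} T_{k}(x)\left(\frac{2x^2-1}{2x^2\sqrt{x^2-1}}\right)^k\bigl(\omega(x)-(-1)^{n-k}\omega^{ -1}(x)\bigr),\\ \sqrt{x^2-1}\sum_{k=0}^n{n\choose k} \frac{U_{2k}(x)}{\big(2x\sqrt{x^2-1}\big)^k}\bigl(1+(-1)^{n-k}\bigr)=\sum_{k=0}^n{n\choose k} \frac{T_{2k}(x)}{\big(2x\sqrt{x^2-1}\big)^k}\bigl(\omega(x)-(-1)^{n-k}\omega^{ -1}(x)\bigr),\\ \sqrt{x^2-1}\sum_{k=1}^n{n\choose k} U_{2k-1}(x) \left( \frac{x}{(2x^2-1)\sqrt{x^2-1}}\right)^k\bigl(1+(-1)^{n-k}\bigr)\\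 =\left(\frac{2x^2}{2x^2-1}\right)^n\sum_{k=0}^n {n\choose k} T_{k}(x) \left(\frac{2x^2-1}{2x^2\sqrt{x^2-1}}\right)^k\bigl(1-(-1)^{n-k}\bigr),\\ \sum_{k=1}^n {n\choose k} \frac{U_{2k-1}(x)}{\big(2x\sqrt{x^2-1}\big)^{k-1}} \bigl(\omega(x)+(-1)^{n-k}\omega^{ -1}(x)\bigr)=2x\sum_{k=0}^n {n\choose k} \frac{T_{2k+1}(x)}{\big(2x\sqrt{x^2-1}\big)^k} \bigl( 1-(-1)^{n-k}\bigr). \end{gather*}
   Context: $T_n(x)$ and $U_n(x)$ are the Chebyshev polynomials of the first and second kind, defined by $W_n(x)=2xW_{n-1}(x)-W_{n-2}(x)$ for $n\geq2$ with $T_0=1$, $T_1=x$, $U_0=1$, $U_1=2x$. Note $\omega(x)^{ -1}=x-\sqrt{x^2-1}$; the same square root is used throughout. The conditions on $x$ only ensure all denominators are nonzero. -}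

module Defs where

open import Level using (Level; _⊔_) renaming (suc to lsuc)
open import Data.Nat as ℕ using (ℕ; zero; suc; _∸_)
open import Data.Nat.Combinatorics using (_C_)
open import Relation.Nullary using (¬_)
open import Algebra.Bundles using (CommutativeRing)

embed : ∀ {c ℓ} (R : CommutativeRing c ℓ) → ℕ → CommutativeRing.Carrier R
embed R zero    = CommutativeRing.0# R
embed R (suc n) = CommutativeRing._+_ R (CommutativeRing.1# R) (embed R n)

-- A field of characteristic zero (the algebraic structure of ℂ that the
-- statement uses).  As in Lean/Mathlib the inverse is a total function;
-- it is only constrained on nonzero elements, and the statement only ever
-- inverts elements that are nonzero under its hypotheses.
record Field c ℓ : Set (lsuc (c ⊔ ℓ)) where
  field
    commutativeRing : CommutativeRing c ℓ
  open CommutativeRing commutativeRing public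
  field
    _⁻¹        : Carrier → Carrier
    0≉1        : ¬ (0# ≈ 1#)
    ⁻¹-inverse : ∀ y → ¬ (y ≈ 0#) → (y * y ⁻¹) ≈ 1#
    char0      : ∀ n → ¬ (embed commutativeRing (suc n) ≈ 0#)

module Cheb {c ℓ} (F : Field c ℓ) where
  open Field F

  ι : ℕ → Carrier
  ι = embed commutativeRing

  2# : Carrier
  2# = 1# + 1#

  infixl 6 _−_
  _−_ : Carrier → Carrier → Carrier
  a − b = a + (- b)

  infixr 8 _^_
  _^_ : Carrier → ℕ → Carrier
  a ^ zero  = 1#
  a ^ suc n = a * (a ^ n)

  sgn : ℕ → Carrier
  sgn zero    = 1#
  sgn (suc m) = - sgn m

  binom : ℕ → ℕ → Carrier
  binom n k = ι (n C k)

  T : ℕ → Carrier → Carrier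
  T zero          x = 1#
  T (suc zero)    x = x
  T (suc (suc n)) x = (2# * x) * T (suc n) x − T n x

  U : ℕ → Carrier → Carrier
  U zero          x = 1#
  U (suc zero)    x = 2# * x
  U (suc (suc n)) x = (2# * x) * U (suc n) x − U n x

  sumLt : ℕ → (ℕ → Carrier) → Carrier
  sumLt zero    f = 0#
  sumLt (suc m) f = sumLt m f + f m

  -- Σ_{k=a}^{b} f k   (empty, i.e. 0, if b < a)
  Σ[_to_] : ℕ → ℕ → (ℕ → Carrier) → Carrier
  Σ[ a to b ] f = sumLt (suc b ∸ a) (λ i → f (a ℕ.+ i))

  -- ω(x) = x + √(x²-1), where s is the chosen square root √(x²-1)
  ω : Carrier → Carrier → Carrier
  ω x s = x + s

{-# OPTIONS --safe #-}
-- Put a = ω = x + s and b = x − s, where s² = x² − 1. Then ab = 1 and a + b = 2x, and the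
-- Chebyshev recurrence gives the Binet forms 2 T_k = a^k + b^k, (a − b) U_k = a^(k+1) − b^(k+1).
-- Substituting them, each side of each identity becomes a pair of sums
-- Σ C(n,k) q^k (α + (−1)^(n−k) β), with q = a or b (or a², b²) times the weight, and such a sum
-- equals α (q + 1)^n + β (q − 1)^n by the binomial theorem. What remains are coincidences
-- between the numbers q ± 1:  a/s − 1 = b/s + 1,  a²/D − 1 = b²/D + 1,  and
-- aA + 1 = P (a²B + 1),  aA − 1 = P (b²B + 1),  bA + 1 = P (a²B − 1),  bA − 1 = P (b²B − 1).
module Submission where

open import Defs
open import Algebra.Bundles using (CommutativeRing)
open import Algebra.Solver.Ring.AlmostCommutativeRing using (fromCommutativeRing; _-Raw-AlmostCommutative⟶_)
open import Data.Fin using (toℕ)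
open import Data.Integer as ℤ using (ℤ; +_; -[1+_])
import Data.Integer.Properties as ℤₚ
open import Data.Maybe using (Maybe; just; nothing)
open import Data.Nat as ℕ using (ℕ; zero; suc; _∸_; _≤_)
open import Data.Nat.Combinatorics using (_C_)
import Data.Nat.Properties as ℕₚ
open import Data.Product using (_×_; _,_; proj₁)
open import Data.Sign as Sign using (Sign)
open import Relation.Binary.PropositionalEquality as ≡ using (_≡_)
open import Relation.Nullary using (¬_; yes; no)
import Algebra.Properties.CommutativeSemiring.Binomial
import Algebra.Properties.Semiring.Exp
import Algebra.Properties.Semiring.Mult
import Algebra.Properties.Semiring.Sum

-- The solvers of the standard library take the coefficients of an abstract commutative ring
-- from the ring itself, where they cannot be compared; here they are integers.
module IntegerCoefficients {c ℓ} (R : CommutativeRing c ℓ) where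
  open CommutativeRing R
  open import Algebra.Properties.Ring ring using (-‿distribˡ-*; -‿involutive; -0#≈0#; -‿+-comm)
  open import Algebra.Properties.Semiring.Mult.TCOptimised semiring
    using (×-homo-+; ×1-homo-*; 1+×) renaming (_×_ to _×′_)
  open import Relation.Binary.Reasoning.Setoid setoid

  -- With the optimised multiple (1 ×′ y = y), :1 and :2 below denote 1# and 2# on the nose.
  ⟦_⟧ : ℤ → Carrier
  ⟦ + n ⟧     = n ×′ 1#
  ⟦ -[1+ n ] ⟧ = - (suc n ×′ 1#)

  sign⟦_⟧ : Sign → Carrier
  sign⟦ Sign.+ ⟧ = 1#
  sign⟦ Sign.- ⟧ = - 1#

  ⟦◃⟧ : ∀ σ n → ⟦ σ ℤ.◃ n ⟧ ≈ sign⟦ σ ⟧ * (n ×′ 1#)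
  ⟦◃⟧ σ      zero    = sym (zeroʳ _)
  ⟦◃⟧ Sign.+ (suc n) = sym (*-identityˡ _)
  ⟦◃⟧ Sign.- (suc n) = sym (trans (sym (-‿distribˡ-* _ _)) (-‿cong (*-identityˡ _)))

  ⟦⟧-signAbs : ∀ i → ⟦ i ⟧ ≈ sign⟦ ℤ.sign i ⟧ * (ℤ.∣ i ∣ ×′ 1#)
  ⟦⟧-signAbs i = trans (reflexive (≡.cong ⟦_⟧ (≡.sym (ℤₚ.◃-inverse i))))
                       (⟦◃⟧ (ℤ.sign i) ℤ.∣ i ∣)

  sign⟦⟧-homo : ∀ σ τ → sign⟦ σ Sign.* τ ⟧ ≈ sign⟦ σ ⟧ * sign⟦ τ ⟧
  sign⟦⟧-homo Sign.+ τ       = sym (*-identityˡ _)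
  sign⟦⟧-homo Sign.- Sign.+ = sym (*-identityʳ _)
  sign⟦⟧-homo Sign.- Sign.- =
    sym (trans (sym (-‿distribˡ-* _ _)) (trans (-‿cong (*-identityˡ _)) (-‿involutive _)))

  ⟦⟧-*-homo : ∀ i j → ⟦ i ℤ.* j ⟧ ≈ ⟦ i ⟧ * ⟦ j ⟧
  ⟦⟧-*-homo i j = begin
    ⟦ i ℤ.* j ⟧
      ≈⟨ ⟦◃⟧ (ℤ.sign i Sign.* ℤ.sign j) (ℤ.∣ i ∣ ℕ.* ℤ.∣ j ∣) ⟩
    sign⟦ ℤ.sign i Sign.* ℤ.sign j ⟧ * ((ℤ.∣ i ∣ ℕ.* ℤ.∣ j ∣) ×′ 1#)
      ≈⟨ *-cong (sign⟦⟧-homo (ℤ.sign i) (ℤ.sign j)) (×1-homo-* ℤ.∣ i ∣ ℤ.∣ j ∣) ⟩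
    (sign⟦ ℤ.sign i ⟧ * sign⟦ ℤ.sign j ⟧) * ((ℤ.∣ i ∣ ×′ 1#) * (ℤ.∣ j ∣ ×′ 1#))
      ≈⟨ interchange _ _ _ _ ⟩
    (sign⟦ ℤ.sign i ⟧ * (ℤ.∣ i ∣ ×′ 1#)) * (sign⟦ ℤ.sign j ⟧ * (ℤ.∣ j ∣ ×′ 1#))
      ≈⟨ *-cong (⟦⟧-signAbs i) (⟦⟧-signAbs j) ⟨
    ⟦ i ⟧ * ⟦ j ⟧ ∎
    where open import Algebra.Properties.CommutativeSemigroup *-commutativeSemigroup using (interchange)

  ⟦⊖⟧ : ∀ m n → ⟦ m ℤ.⊖ n ⟧ ≈ m ×′ 1# - n ×′ 1#
  ⟦⊖⟧ zero    zero    = sym (trans (+-identityˡ _) -0#≈0#)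
  ⟦⊖⟧ zero    (suc n) = sym (+-identityˡ _)
  ⟦⊖⟧ (suc m) zero    = sym (trans (+-congˡ -0#≈0#) (+-identityʳ _))
  ⟦⊖⟧ (suc m) (suc n) = begin
    ⟦ suc m ℤ.⊖ suc n ⟧                ≡⟨ ≡.cong ⟦_⟧ (ℤₚ.[1+m]⊖[1+n]≡m⊖n m n) ⟩
    ⟦ m ℤ.⊖ n ⟧                        ≈⟨ ⟦⊖⟧ m n ⟩
    m ×′ 1# - n ×′ 1#                  ≈⟨ +-identityˡ _ ⟨
    0# + (m ×′ 1# - n ×′ 1#)           ≈⟨ +-congʳ (-‿inverseʳ 1#) ⟨
    (1# - 1#) + (m ×′ 1# - n ×′ 1#)    ≈⟨ +-interchange _ _ _ _ ⟩
    (1# + m ×′ 1#) + (- 1# - n ×′ 1#)  ≈⟨ +-congˡ (-‿+-comm 1# (n ×′ 1#)) ⟩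
    (1# + m ×′ 1#) - (1# + n ×′ 1#)    ≈⟨ +-cong (1+× m 1#) (-‿cong (1+× n 1#)) ⟨
    suc m ×′ 1# - suc n ×′ 1#          ∎
    where open import Algebra.Properties.CommutativeSemigroup +-commutativeSemigroup
            using () renaming (interchange to +-interchange)

  ⟦⟧-+-homo : ∀ i j → ⟦ i ℤ.+ j ⟧ ≈ ⟦ i ⟧ + ⟦ j ⟧
  ⟦⟧-+-homo (+ m)    (+ n)    = ×-homo-+ 1# m n
  ⟦⟧-+-homo (+ m)    -[1+ n ] = ⟦⊖⟧ m (suc n)
  ⟦⟧-+-homo -[1+ m ] (+ n)    = trans (⟦⊖⟧ n (suc m)) (+-comm _ _)
  ⟦⟧-+-homo -[1+ m ] -[1+ n ] = begin
    - (suc (suc (m ℕ.+ n)) ×′ 1#)   ≡⟨ ≡.cong (λ k → - (suc k ×′ 1#)) (ℕₚ.+-suc m n) ⟨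
    - ((suc m ℕ.+ suc n) ×′ 1#)     ≈⟨ -‿cong (×-homo-+ 1# (suc m) (suc n)) ⟩
    - (suc m ×′ 1# + suc n ×′ 1#)   ≈⟨ -‿+-comm _ _ ⟨
    - (suc m ×′ 1#) - suc n ×′ 1#   ∎

  ⟦⟧-‿homo : ∀ i → ⟦ ℤ.- i ⟧ ≈ - ⟦ i ⟧
  ⟦⟧-‿homo -[1+ n ]  = sym (-‿involutive _)
  ⟦⟧-‿homo (+ zero)  = sym -0#≈0#
  ⟦⟧-‿homo (+ suc n) = refl

  homomorphism : ℤ.+-*-rawRing -Raw-AlmostCommutative⟶ fromCommutativeRing R
  homomorphism = record
    { ⟦_⟧    = ⟦_⟧
    ; +-homo = ⟦⟧-+-homo
    ; *-homo = ⟦⟧-*-homo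
    ; -‿homo = ⟦⟧-‿homo
    ; 0-homo = refl
    ; 1-homo = refl
    }

  _≟⟦⟧_ : ∀ i j → Maybe (⟦ i ⟧ ≈ ⟦ j ⟧)
  i ≟⟦⟧ j with i ℤ.≟ j
  ... | yes ≡.refl = just refl
  ... | no _       = nothing

  open import Algebra.Solver.Ring ℤ.+-*-rawRing (fromCommutativeRing R) homomorphism _≟⟦⟧_ public
    using (Polynomial; solve; _:=_; con; _:+_; _:*_; :-_; _:-_)

  :0 :1 :2 : ∀ {j} → Polynomial j
  :0 = con (+ 0)
  :1 = con (+ 1)
  :2 = con (+ 2)

2*suc : ∀ k → 2 ℕ.* suc k ≡ suc (suc (2 ℕ.* k))
2*suc k = ≡.cong suc (ℕₚ.+-suc k (k ℕ.+ 0))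

module FieldLemmas {c ℓ} (F : Field c ℓ) where
  open Field F
  open Cheb F
  open IntegerCoefficients commutativeRing
  open import Relation.Binary.Reasoning.Setoid setoid

  *≈1⇒≉0 : ∀ {y z} → y * z ≈ 1# → ¬ (y ≈ 0#)
  *≈1⇒≉0 {y} {z} yz≈1 y≈0 = 0≉1 (begin
    0#     ≈⟨ zeroˡ z ⟨
    0# * z ≈⟨ *-congʳ y≈0 ⟨
    y * z  ≈⟨ yz≈1 ⟩
    1#     ∎)

  ⁻¹-unique : ∀ {y z} → y * z ≈ 1# → y ⁻¹ ≈ z
  ⁻¹-unique {y} {z} yz≈1 = begin
    y ⁻¹             ≈⟨ *-identityʳ _ ⟨
    y ⁻¹ * 1#        ≈⟨ *-congˡ yz≈1 ⟨
    y ⁻¹ * (y * z)   ≈⟨ *-assoc _ _ _ ⟨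
    (y ⁻¹ * y) * z   ≈⟨ *-congʳ (trans (*-comm _ _) (⁻¹-inverse y (*≈1⇒≉0 yz≈1))) ⟩
    1# * z           ≈⟨ *-identityˡ z ⟩
    z                ∎

  inverse-of-product : ∀ {y z} → ¬ (y ≈ 0#) → ¬ (z ≈ 0#) → (y * z) * (y ⁻¹ * z ⁻¹) ≈ 1#
  inverse-of-product {y} {z} y≉0 z≉0 = begin
    (y * z) * (y ⁻¹ * z ⁻¹)   ≈⟨ solve 4 (λ y z y′ z′ → (y :* z) :* (y′ :* z′) := (y :* y′) :* (z :* z′))
                                         refl y z (y ⁻¹) (z ⁻¹) ⟩
    (y * y ⁻¹) * (z * z ⁻¹)   ≈⟨ *-cong (⁻¹-inverse y y≉0) (⁻¹-inverse z z≉0) ⟩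
    1# * 1#                   ≈⟨ *-identityˡ 1# ⟩
    1#                        ∎

  *-≉0 : ∀ {y z} → ¬ (y ≈ 0#) → ¬ (z ≈ 0#) → ¬ (y * z ≈ 0#)
  *-≉0 y≉0 z≉0 = *≈1⇒≉0 (inverse-of-product y≉0 z≉0)

  ⁻¹-distrib-* : ∀ {y z} → ¬ (y ≈ 0#) → ¬ (z ≈ 0#) → (y * z) ⁻¹ ≈ y ⁻¹ * z ⁻¹
  ⁻¹-distrib-* y≉0 z≉0 = ⁻¹-unique (inverse-of-product y≉0 z≉0)

  isolate : ∀ {c c′ y z} → c′ * c ≈ 1# → c * y ≈ z → y ≈ c′ * z
  isolate {c} {c′} {y} {z} c′c≈1 cy≈z = begin
    y               ≈⟨ *-identityˡ y ⟨
    1# * y          ≈⟨ *-congʳ c′c≈1 ⟨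
    (c′ * c) * y    ≈⟨ *-assoc _ _ _ ⟩
    c′ * (c * y)    ≈⟨ *-congˡ cy≈z ⟩
    c′ * z          ∎

  *-cancelˡ : ∀ {c y z} → ¬ (c ≈ 0#) → c * y ≈ c * z → y ≈ z
  *-cancelˡ {c} {y} {z} c≉0 cy≈cz = begin
    y               ≈⟨ isolate c⁻¹c≈1 cy≈cz ⟩
    c ⁻¹ * (c * z)  ≈⟨ isolate c⁻¹c≈1 refl ⟨
    z               ∎
    where c⁻¹c≈1 = trans (*-comm _ _) (⁻¹-inverse c c≉0)

  *-⁻¹-cancel : ∀ {c} y → ¬ (c ≈ 0#) → c * (y * c ⁻¹) ≈ y
  *-⁻¹-cancel {c} y c≉0 = begin
    c * (y * c ⁻¹)  ≈⟨ solve 3 (λ c y c′ → c :* (y :* c′) := y :* (c :* c′)) refl c y (c ⁻¹) ⟩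
    y * (c * c ⁻¹)  ≈⟨ *-congˡ (⁻¹-inverse c c≉0) ⟩
    y * 1#          ≈⟨ *-identityʳ y ⟩
    y               ∎

  drop-unit : ∀ {c y z} → c ≈ 1# → y ≈ c * z → y ≈ z
  drop-unit c≈1 y≈cz = trans y≈cz (trans (*-congʳ c≈1) (*-identityˡ _))

  ^-congˡ : ∀ {y z} k → y ≈ z → y ^ k ≈ z ^ k
  ^-congˡ zero    y≈z = refl
  ^-congˡ (suc k) y≈z = *-cong y≈z (^-congˡ k y≈z)

  ^-distrib-* : ∀ y z k → (y * z) ^ k ≈ y ^ k * z ^ k
  ^-distrib-* y z zero    = sym (*-identityˡ 1#)
  ^-distrib-* y z (suc k) = begin
    (y * z) * (y * z) ^ k       ≈⟨ *-congˡ (^-distrib-* y z k) ⟩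
    (y * z) * (y ^ k * z ^ k)   ≈⟨ solve 4 (λ y z p q → (y :* z) :* (p :* q) := (y :* p) :* (z :* q))
                                           refl y z (y ^ k) (z ^ k) ⟩
    (y * y ^ k) * (z * z ^ k)   ∎

  1^ : ∀ k → 1# ^ k ≈ 1#
  1^ zero    = refl
  1^ (suc k) = trans (*-identityˡ _) (1^ k)

  ^-⁻¹ : ∀ {y z} k → y * z ≈ 1# → (y ^ k) ⁻¹ ≈ z ^ k
  ^-⁻¹ {y} {z} k yz≈1 = ⁻¹-unique (begin
    y ^ k * z ^ k  ≈⟨ ^-distrib-* y z k ⟨
    (y * z) ^ k    ≈⟨ ^-congˡ k yz≈1 ⟩
    1# ^ k         ≈⟨ 1^ k ⟩
    1#             ∎)

  ^-shift : ∀ {c y} k → c * y ≈ 1# → y ^ k ≈ c * y ^ suc k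
  ^-shift {c} {y} k cy≈1 = begin
    y ^ k              ≈⟨ *-identityˡ _ ⟨
    1# * y ^ k         ≈⟨ *-congʳ cy≈1 ⟨
    (c * y) * y ^ k    ≈⟨ *-assoc _ _ _ ⟩
    c * (y * y ^ k)    ∎

  ^-⁻¹-scaled : ∀ {y} k → ¬ (y ≈ 0#) → (y ^ k) ⁻¹ ≈ 1# * y ⁻¹ ^ k
  ^-⁻¹-scaled k y≉0 = trans (^-⁻¹ k (⁻¹-inverse _ y≉0)) (sym (*-identityˡ _))

  ^-⁻¹-shifted : ∀ {y} k → ¬ (y ≈ 0#) → (y ^ k) ⁻¹ ≈ y * y ⁻¹ ^ suc k
  ^-⁻¹-shifted k y≉0 = trans (^-⁻¹ k (⁻¹-inverse _ y≉0)) (^-shift k (⁻¹-inverse _ y≉0))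

  ^-double : ∀ y k → y ^ (2 ℕ.* k) ≈ (y * y) ^ k
  ^-double y zero    = refl
  ^-double y (suc k) = begin
    y ^ (2 ℕ.* suc k)         ≡⟨ ≡.cong (y ^_) (2*suc k) ⟩
    y * (y * y ^ (2 ℕ.* k))   ≈⟨ *-assoc _ _ _ ⟨
    (y * y) * y ^ (2 ℕ.* k)   ≈⟨ *-congˡ (^-double y k) ⟩
    (y * y) * (y * y) ^ k     ∎

  sgn≈-1^ : ∀ m → sgn m ≈ (- 1#) ^ m
  sgn≈-1^ zero    = refl
  sgn≈-1^ (suc m) = trans (-‿cong (sgn≈-1^ m)) (solve 1 (λ p → :- p := (:- :1) :* p) refl _)

  ratio-shift : ∀ {c y z} → ¬ (c ≈ 0#) → y − c ≈ z + c → y * c ⁻¹ − 1# ≈ z * c ⁻¹ + 1#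
  ratio-shift {c} {y} {z} c≉0 y-c≈z+c = *-cancelˡ c≉0 (begin
    c * (y * c ⁻¹ − 1#)          ≈⟨ solve 3 (λ c y c′ → c :* (y :* c′ :- :1) := c :* (y :* c′) :- c)
                                            refl c y (c ⁻¹) ⟩
    c * (y * c ⁻¹) − c           ≈⟨ +-congʳ (*-⁻¹-cancel y c≉0) ⟩
    y − c                        ≈⟨ y-c≈z+c ⟩
    z + c                        ≈⟨ +-congʳ (*-⁻¹-cancel z c≉0) ⟨
    c * (z * c ⁻¹) + c           ≈⟨ solve 3 (λ c z c′ → c :* (z :* c′) :+ c := c :* (z :* c′ :+ :1))
                                            refl c z (c ⁻¹) ⟩
    c * (z * c ⁻¹ + 1#)          ∎)

module BinomialSums {c ℓ} (F : Field c ℓ) where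
  open Field F
  open Cheb F
  open FieldLemmas F
  open IntegerCoefficients commutativeRing
  open import Relation.Binary.Reasoning.Setoid setoid

  sumLt-cong : ∀ m {f g : ℕ → Carrier} → (∀ i → f i ≈ g i) → sumLt m f ≈ sumLt m g
  sumLt-cong zero    f≈g = refl
  sumLt-cong (suc m) f≈g = +-cong (sumLt-cong m f≈g) (f≈g m)

  sumLt-linear : ∀ m K₁ K₂ (f g : ℕ → Carrier) →
                 sumLt m (λ i → K₁ * f i + K₂ * g i) ≈ K₁ * sumLt m f + K₂ * sumLt m g
  sumLt-linear zero    K₁ K₂ f g = solve 2 (λ K₁ K₂ → :0 := K₁ :* :0 :+ K₂ :* :0) refl K₁ K₂
  sumLt-linear (suc m) K₁ K₂ f g = begin
    sumLt m (λ i → K₁ * f i + K₂ * g i) + (K₁ * f m + K₂ * g m)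
      ≈⟨ +-congʳ (sumLt-linear m K₁ K₂ f g) ⟩
    (K₁ * sumLt m f + K₂ * sumLt m g) + (K₁ * f m + K₂ * g m)
      ≈⟨ solve 6 (λ K₁ K₂ S T p q → (K₁ :* S :+ K₂ :* T) :+ (K₁ :* p :+ K₂ :* q)
                                   := K₁ :* (S :+ p) :+ K₂ :* (T :+ q)) refl K₁ K₂ _ _ _ _ ⟩
    K₁ * (sumLt m f + f m) + K₂ * (sumLt m g + g m) ∎

  sumLt-peel : ∀ m (f : ℕ → Carrier) → sumLt (suc m) f ≈ f 0 + sumLt m (λ i → f (suc i))
  sumLt-peel zero    f = trans (+-identityˡ _) (sym (+-identityʳ _))
  sumLt-peel (suc m) f = trans (+-congʳ (sumLt-peel m f)) (+-assoc _ _ _)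

  private
    module Exp  = Algebra.Properties.Semiring.Exp semiring
    module Sum  = Algebra.Properties.Semiring.Sum semiring
    module Mult = Algebra.Properties.Semiring.Mult semiring
    module Binomial = Algebra.Properties.CommutativeSemiring.Binomial commutativeSemiring

  sumLt≈sum : ∀ m (f : ℕ → Carrier) → sumLt m f ≈ Sum.sum {m} (λ i → f (toℕ i))
  sumLt≈sum zero    f = refl
  sumLt≈sum (suc m) f = trans (sumLt-peel m f) (+-congˡ (sumLt≈sum m (λ i → f (suc i))))

  ^≈stdlib^ : ∀ y k → y ^ k ≈ y Exp.^ k
  ^≈stdlib^ y zero    = refl
  ^≈stdlib^ y (suc k) = *-congˡ (^≈stdlib^ y k)

  embed*≈× : ∀ k y → ι k * y ≈ k Mult.× y
  embed*≈× zero    y = zeroˡ y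
  embed*≈× (suc k) y = trans (distribʳ y 1# (ι k)) (+-cong (*-identityˡ y) (embed*≈× k y))

  binomial-theorem : ∀ n q r → Σ[ 0 to n ] (λ k → binom n k * q ^ k * r ^ (n ∸ k)) ≈ (q + r) ^ n
  binomial-theorem n q r = begin
    sumLt (suc n) (λ k → binom n k * q ^ k * r ^ (n ∸ k))
      ≈⟨ sumLt≈sum (suc n) _ ⟩
    Sum.sum {suc n} (λ i → binom n (toℕ i) * q ^ toℕ i * r ^ (n ∸ toℕ i))
      ≈⟨ Sum.sum-cong-≋ {suc n} term ⟩
    Binomial.binomialExpansion q r n
      ≈⟨ Binomial.theorem n q r ⟨
    (q + r) Exp.^ n
      ≈⟨ ^≈stdlib^ (q + r) n ⟨
    (q + r) ^ n ∎
    where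
    term : ∀ i → binom n (toℕ i) * q ^ toℕ i * r ^ (n ∸ toℕ i)
               ≈ (n C toℕ i) Mult.× (q Exp.^ toℕ i * r Exp.^ (n ∸ toℕ i))
    term i = trans (*-assoc _ _ _)
      (trans (embed*≈× (n C toℕ i) _)
             (Mult.×-congʳ (n C toℕ i) (*-cong (^≈stdlib^ q (toℕ i)) (^≈stdlib^ r (n ∸ toℕ i)))))

  binomial-twist : ∀ n q α β →
    Σ[ 0 to n ] (λ k → binom n k * q ^ k * (α + sgn (n ∸ k) * β))
      ≈ α * (q + 1#) ^ n + β * (q − 1#) ^ n
  binomial-twist n q α β = begin
    sumLt (suc n) (λ k → binom n k * q ^ k * (α + sgn (n ∸ k) * β))
      ≈⟨ sumLt-cong (suc n) split ⟩
    sumLt (suc n) (λ k → α * (binom n k * q ^ k * 1# ^ (n ∸ k))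
                       + β * (binom n k * q ^ k * (- 1#) ^ (n ∸ k)))
      ≈⟨ sumLt-linear (suc n) α β _ _ ⟩
    α * Σ[ 0 to n ] (λ k → binom n k * q ^ k * 1# ^ (n ∸ k))
      + β * Σ[ 0 to n ] (λ k → binom n k * q ^ k * (- 1#) ^ (n ∸ k))
      ≈⟨ +-cong (*-congˡ (binomial-theorem n q 1#)) (*-congˡ (binomial-theorem n q (- 1#))) ⟩
    α * (q + 1#) ^ n + β * (q − 1#) ^ n ∎
    where
    split : ∀ k → binom n k * q ^ k * (α + sgn (n ∸ k) * β)
                ≈ α * (binom n k * q ^ k * 1# ^ (n ∸ k)) + β * (binom n k * q ^ k * (- 1#) ^ (n ∸ k))
    split k = begin
      binom n k * q ^ k * (α + sgn (n ∸ k) * β)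
        ≈⟨ solve 5 (λ C Q α β σ → C :* Q :* (α :+ σ :* β) := α :* (C :* Q :* :1) :+ β :* (C :* Q :* σ))
                   refl (binom n k) (q ^ k) α β (sgn (n ∸ k)) ⟩
      α * (binom n k * q ^ k * 1#) + β * (binom n k * q ^ k * sgn (n ∸ k))
        ≈⟨ +-cong (*-congˡ (*-congˡ (1^ (n ∸ k)))) (*-congˡ (*-congˡ (sym (sgn≈-1^ (n ∸ k))))) ⟨
      α * (binom n k * q ^ k * 1# ^ (n ∸ k)) + β * (binom n k * q ^ k * (- 1#) ^ (n ∸ k)) ∎

  pairForm : (K₁ K₂ α β p m p′ m′ : Carrier) → Carrier
  pairForm K₁ K₂ α β p m p′ m′ = K₁ * (α * p + β * m) + K₂ * (α * p′ + β * m′)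

  pairForm-cong : ∀ {K₁ K₂ α β p m p′ m′ P M P′ M′} → p ≈ P → m ≈ M → p′ ≈ P′ → m′ ≈ M′ →
                  pairForm K₁ K₂ α β p m p′ m′ ≈ pairForm K₁ K₂ α β P M P′ M′
  pairForm-cong p≈ m≈ p′≈ m′≈ =
    +-cong (*-congˡ (+-cong (*-congˡ p≈) (*-congˡ m≈))) (*-congˡ (+-cong (*-congˡ p′≈) (*-congˡ m′≈)))

  :pairForm : ∀ {j} → (K₁ K₂ α β p m p′ m′ : Polynomial j) → Polynomial j
  :pairForm K₁ K₂ α β p m p′ m′ = K₁ :* (α :* p :+ β :* m) :+ K₂ :* (α :* p′ :+ β :* m′)

  weighted-binet : ∀ {X Y K K′ c p₁ p₂ r₁ r₂ y} k →
    X ≈ K * (p₁ * r₁ ^ k + p₂ * r₂ ^ k) → Y ≈ c * y ^ k → K * c ≈ K′ →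
    X * Y ≈ (K′ * p₁) * (r₁ * y) ^ k + (K′ * p₂) * (r₂ * y) ^ k
  weighted-binet {X} {Y} {K} {K′} {c} {p₁} {p₂} {r₁} {r₂} {y} k X≈ Y≈ Kc≈K′ = begin
    X * Y
      ≈⟨ *-cong X≈ Y≈ ⟩
    K * (p₁ * r₁ ^ k + p₂ * r₂ ^ k) * (c * y ^ k)
      ≈⟨ solve 7 (λ K c p₁ p₂ R₁ R₂ Y → K :* (p₁ :* R₁ :+ p₂ :* R₂) :* (c :* Y)
                   := (K :* c) :* p₁ :* (R₁ :* Y) :+ (K :* c) :* p₂ :* (R₂ :* Y))
                 refl K c p₁ p₂ (r₁ ^ k) (r₂ ^ k) (y ^ k) ⟩
    (K * c) * p₁ * (r₁ ^ k * y ^ k) + (K * c) * p₂ * (r₂ ^ k * y ^ k)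
      ≈⟨ +-cong (*-cong (*-congʳ Kc≈K′) (sym (^-distrib-* r₁ y k)))
                (*-cong (*-congʳ Kc≈K′) (sym (^-distrib-* r₂ y k))) ⟩
    (K′ * p₁) * (r₁ * y) ^ k + (K′ * p₂) * (r₂ * y) ^ k ∎

  module TwistedPair (n : ℕ) {K₁ q₁ K₂ q₂ α β : Carrier} where

    pairTerm : ℕ → Carrier
    pairTerm k = K₁ * (binom n k * q₁ ^ k * (α + sgn (n ∸ k) * β))
               + K₂ * (binom n k * q₂ ^ k * (α + sgn (n ∸ k) * β))

    closedForm : Carrier
    closedForm = pairForm K₁ K₂ α β ((q₁ + 1#) ^ n) ((q₁ − 1#) ^ n) ((q₂ + 1#) ^ n) ((q₂ − 1#) ^ n)

    pairTerm-sum : Σ[ 0 to n ] pairTerm ≈ closedForm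
    pairTerm-sum = trans (sumLt-linear (suc n) K₁ K₂ _ _)
                         (+-cong (*-congˡ (binomial-twist n q₁ α β)) (*-congˡ (binomial-twist n q₂ α β)))

    summand≈pairTerm : ∀ {X Y Z} k → X * Y ≈ K₁ * q₁ ^ k + K₂ * q₂ ^ k → Z ≈ α + sgn (n ∸ k) * β →
                       binom n k * X * Y * Z ≈ pairTerm k
    summand≈pairTerm {X} {Y} {Z} k XY≈ Z≈ = begin
      binom n k * X * Y * Z
        ≈⟨ solve 4 (λ C X Y Z → C :* X :* Y :* Z := C :* (X :* Y) :* Z) refl (binom n k) X Y Z ⟩
      binom n k * (X * Y) * Z
        ≈⟨ *-cong (*-congˡ XY≈) Z≈ ⟩
      binom n k * (K₁ * q₁ ^ k + K₂ * q₂ ^ k) * (α + sgn (n ∸ k) * β)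
        ≈⟨ solve 8 (λ C K₁ Q₁ K₂ Q₂ α β σ → C :* (K₁ :* Q₁ :+ K₂ :* Q₂) :* (α :+ σ :* β)
                     := K₁ :* (C :* Q₁ :* (α :+ σ :* β)) :+ K₂ :* (C :* Q₂ :* (α :+ σ :* β)))
                   refl (binom n k) K₁ (q₁ ^ k) K₂ (q₂ ^ k) α β (sgn (n ∸ k)) ⟩
      pairTerm k ∎

    twisted-pair-sum : ∀ {X Y Z : ℕ → Carrier} →
      (∀ k → X k * Y k ≈ K₁ * q₁ ^ k + K₂ * q₂ ^ k) →
      (∀ k → Z k ≈ α + sgn (n ∸ k) * β) →
      Σ[ 0 to n ] (λ k → binom n k * X k * Y k * Z k) ≈ closedForm
    twisted-pair-sum XY≈ Z≈ = trans (sumLt-cong (suc n) (λ k → summand≈pairTerm k (XY≈ k) (Z≈ k))) pairTerm-sum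

    twisted-pair-sum₁ : ∀ {X Y Z : ℕ → Carrier} →
      (∀ k → X (suc k) * Y (suc k) ≈ K₁ * q₁ ^ suc k + K₂ * q₂ ^ suc k) →
      (∀ k → Z k ≈ α + sgn (n ∸ k) * β) →
      K₁ + K₂ ≈ 0# →
      Σ[ 1 to n ] (λ k → binom n k * X k * Y k * Z k) ≈ closedForm
    twisted-pair-sum₁ XY≈ Z≈ K₁+K₂≈0 = begin
      sumLt n (λ i → binom n (suc i) * _ * _ * _)
        ≈⟨ sumLt-cong n (λ i → summand≈pairTerm (suc i) (XY≈ i) (Z≈ (suc i))) ⟩
      sumLt n (λ i → pairTerm (suc i))
        ≈⟨ +-identityˡ _ ⟨
      0# + sumLt n (λ i → pairTerm (suc i))
        ≈⟨ +-congʳ pairTerm₀≈0 ⟨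
      pairTerm 0 + sumLt n (λ i → pairTerm (suc i))
        ≈⟨ sumLt-peel n pairTerm ⟨
      Σ[ 0 to n ] pairTerm
        ≈⟨ pairTerm-sum ⟩
      closedForm ∎
      where
      pairTerm₀≈0 : pairTerm 0 ≈ 0#
      pairTerm₀≈0 = trans (sym (distribʳ _ K₁ K₂)) (trans (*-congʳ K₁+K₂≈0) (zeroˡ _))

module ChebyshevRecurrence {c ℓ} (F : Field c ℓ) where
  open Field F
  open Cheb F
  open IntegerCoefficients commutativeRing
  open import Relation.Binary.Reasoning.Setoid setoid

  module _ (x : Carrier) where

    Recurrent : (ℕ → Carrier) → Set ℓ
    Recurrent f = ∀ k → f (suc (suc k)) ≈ (2# * x) * f (suc k) − f k

    recurrent-unique : ∀ {f g} → Recurrent f → Recurrent g → f 0 ≈ g 0 → f 1 ≈ g 1 → ∀ k → f k ≈ g k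
    recurrent-unique {f} {g} rf rg f₀≈g₀ f₁≈g₁ k = proj₁ (agree k)
      where
      agree : ∀ k → f k ≈ g k × f (suc k) ≈ g (suc k)
      agree zero    = f₀≈g₀ , f₁≈g₁
      agree (suc k) = let (eq , eq′) = agree k in
        eq′ , trans (rf k) (trans (+-cong (*-congˡ eq′) (-‿cong eq)) (sym (rg k)))

    recurrent-scale : ∀ {f} c → Recurrent f → Recurrent (λ k → c * f k)
    recurrent-scale {f} c rf k = trans (*-congˡ (rf k))
      (solve 4 (λ c x p q → c :* (:2 :* x :* p :- q) := :2 :* x :* (c :* p) :- c :* q) refl c x _ _)

    recurrent-+ : ∀ {f g} → Recurrent f → Recurrent g → Recurrent (λ k → f k + g k)
    recurrent-+ rf rg k = trans (+-cong (rf k) (rg k))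
      (solve 5 (λ x p q p′ q′ → (:2 :* x :* p :- q) :+ (:2 :* x :* p′ :- q′)
                                := :2 :* x :* (p :+ p′) :- (q :+ q′)) refl x _ _ _ _)

    recurrent-− : ∀ {f g} → Recurrent f → Recurrent g → Recurrent (λ k → f k − g k)
    recurrent-− rf rg k = trans (+-cong (rf k) (-‿cong (rg k)))
      (solve 5 (λ x p q p′ q′ → (:2 :* x :* p :- q) :- (:2 :* x :* p′ :- q′)
                                := :2 :* x :* (p :- p′) :- (q :- q′)) refl x _ _ _ _)

    recurrent-shift : ∀ {f} → Recurrent f → Recurrent (λ k → f (suc k))
    recurrent-shift rf k = rf (suc k)

    T-recurrent : Recurrent (λ k → T k x)
    T-recurrent k = refl

    U-recurrent : Recurrent (λ k → U k x)
    U-recurrent k = refl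

    root-recurrent : ∀ {ρ} → ρ * ρ ≈ (2# * x) * ρ − 1# → Recurrent (λ k → ρ ^ k)
    root-recurrent {ρ} ρ² k = begin
      ρ * (ρ * ρ ^ k)             ≈⟨ *-assoc _ _ _ ⟨
      (ρ * ρ) * ρ ^ k             ≈⟨ *-congʳ ρ² ⟩
      ((2# * x) * ρ − 1#) * ρ ^ k ≈⟨ solve 3 (λ x ρ p → (:2 :* x :* ρ :- :1) :* p
                                               := :2 :* x :* (ρ :* p) :- p) refl x ρ (ρ ^ k) ⟩
      (2# * x) * (ρ * ρ ^ k) − ρ ^ k ∎

  module Binet {x a b : Carrier} (ab≈1 : a * b ≈ 1#) (a+b≈2x : a + b ≈ 2# * x) where

    root : ∀ {ρ σ} → ρ * σ ≈ 1# → ρ + σ ≈ 2# * x → ρ * ρ ≈ (2# * x) * ρ − 1#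
    root {ρ} {σ} ρσ≈1 ρ+σ≈2x = begin
      ρ * ρ                  ≈⟨ solve 2 (λ ρ σ → ρ :* ρ := (ρ :+ σ) :* ρ :- ρ :* σ) refl ρ σ ⟩
      (ρ + σ) * ρ − ρ * σ    ≈⟨ +-cong (*-congʳ ρ+σ≈2x) (-‿cong ρσ≈1) ⟩
      (2# * x) * ρ − 1#      ∎

    a-recurrent : Recurrent x (λ k → a ^ k)
    a-recurrent = root-recurrent x (root ab≈1 a+b≈2x)

    b-recurrent : Recurrent x (λ k → b ^ k)
    b-recurrent = root-recurrent x (root (trans (*-comm b a) ab≈1) (trans (+-comm b a) a+b≈2x))

    T-binet : ∀ k → 2# * T k x ≈ a ^ k + b ^ k
    T-binet = recurrent-unique x (recurrent-scale x 2# (T-recurrent x)) (recurrent-+ x a-recurrent b-recurrent)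
      (*-identityʳ 2#)
      (trans (sym a+b≈2x) (sym (+-cong (*-identityʳ a) (*-identityʳ b))))

    U-binet : ∀ k → (a − b) * U k x ≈ a ^ suc k − b ^ suc k
    U-binet = recurrent-unique x (recurrent-scale x (a − b) (U-recurrent x))
      (recurrent-− x (recurrent-shift x a-recurrent) (recurrent-shift x b-recurrent))
      (solve 2 (λ a b → (a :- b) :* :1 := a :* :1 :- b :* :1) refl a b)
      (trans (*-congˡ (sym a+b≈2x))
             (solve 2 (λ a b → (a :- b) :* (a :+ b) := a :* (a :* :1) :- b :* (b :* :1)) refl a b))

module _ {c ℓ} (F : Field c ℓ) where
  open Field F
  open Cheb F
  open FieldLemmas F
  open BinomialSums F
  open ChebyshevRecurrence F
  open IntegerCoefficients commutativeRing
  open import Algebra.Properties.Ring ring using (x∙y⁻¹≈ε⇒x≈y; x≈y⇒x∙y⁻¹≈ε)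
  open import Relation.Binary.Reasoning.Setoid setoid

  module AtPoint (x s : Carrier) (x≉0 : ¬ (x ≈ 0#)) (x²≉1 : ¬ ((x * x) ≈ 1#))
                 (2x²≉1 : ¬ ((2# * (x * x)) ≈ 1#)) (s² : (s * s) ≈ ((x * x) − 1#)) where

    a b D u v h : Carrier
    a = ω x s
    b = x − s
    D = (2# * x) * s
    u = 2# * (x * x) − 1#
    v = 2# * (x * x)
    h = 2# ⁻¹

    -- A, B, P, Q and D unfold to the abbreviations in the statement of corollary9.
    A B P Q : Carrier
    A = u * ((v * s) ⁻¹)
    B = x * ((u * s) ⁻¹)
    P = u * v ⁻¹
    Q = v * u ⁻¹

    -- The only use of the characteristic.
    2≉0 : ¬ (2# ≈ 0#)
    2≉0 2≈0 = char0 1 (trans (+-congˡ (+-identityʳ 1#)) 2≈0)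

    s≉0 : ¬ (s ≈ 0#)
    s≉0 s≈0 = x²≉1 (x∙y⁻¹≈ε⇒x≈y _ _ (begin
      x * x − 1#  ≈⟨ s² ⟨
      s * s       ≈⟨ *-congʳ s≈0 ⟩
      0# * s      ≈⟨ zeroˡ s ⟩
      0#          ∎))

    u≉0 : ¬ (u ≈ 0#)
    u≉0 u≈0 = 2x²≉1 (x∙y⁻¹≈ε⇒x≈y _ _ u≈0)

    v≉0 : ¬ (v ≈ 0#)
    v≉0 = *-≉0 2≉0 (*-≉0 x≉0 x≉0)

    D≉0 : ¬ (D ≈ 0#)
    D≉0 = *-≉0 (*-≉0 2≉0 x≉0) s≉0

    h*2≈1 : h * 2# ≈ 1#
    h*2≈1 = trans (*-comm h 2#) (⁻¹-inverse 2# 2≉0)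

    s*s⁻¹≈1 : s * s ⁻¹ ≈ 1#
    s*s⁻¹≈1 = ⁻¹-inverse s s≉0

    D*D⁻¹≈1 : D * D ⁻¹ ≈ 1#
    D*D⁻¹≈1 = ⁻¹-inverse D D≉0

    ab≈1 : a * b ≈ 1#
    ab≈1 = begin
      (x + s) * (x − s)     ≈⟨ solve 2 (λ x s → (x :+ s) :* (x :- s) := x :* x :- s :* s) refl x s ⟩
      x * x − s * s         ≈⟨ +-congˡ (-‿cong s²) ⟩
      x * x − (x * x − 1#)  ≈⟨ solve 1 (λ x → x :* x :- (x :* x :- :1) := :1) refl x ⟩
      1#                    ∎

    a+b≈2x : a + b ≈ 2# * x
    a+b≈2x = solve 2 (λ x s → (x :+ s) :+ (x :- s) := :2 :* x) refl x s

    ω⁻¹≈b : (ω x s) ⁻¹ ≈ b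
    ω⁻¹≈b = ⁻¹-unique ab≈1

    QP≈1 : Q * P ≈ 1#
    QP≈1 = begin
      (v * u ⁻¹) * (u * v ⁻¹)   ≈⟨ solve 4 (λ v u u′ v′ → (v :* u′) :* (u :* v′) := (v :* v′) :* (u :* u′))
                                           refl v u (u ⁻¹) (v ⁻¹) ⟩
      (v * v ⁻¹) * (u * u ⁻¹)   ≈⟨ *-cong (⁻¹-inverse v v≉0) (⁻¹-inverse u u≉0) ⟩
      1# * 1#                   ≈⟨ *-identityʳ 1# ⟩
      1#                        ∎

    open Binet ab≈1 a+b≈2x

    T-closed : ∀ k → T k x ≈ h * (a ^ k + b ^ k)
    T-closed k = isolate h*2≈1 (T-binet k)

    U-closed : ∀ k → U k x ≈ (h * s ⁻¹) * (a ^ suc k − b ^ suc k)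
    U-closed k = isolate hs⁻¹[a-b]≈1 (U-binet k)
      where
      hs⁻¹[a-b]≈1 : (h * s ⁻¹) * (a − b) ≈ 1#
      hs⁻¹[a-b]≈1 = begin
        (h * s ⁻¹) * ((x + s) − (x − s))
          ≈⟨ solve 4 (λ x s h s′ → (h :* s′) :* ((x :+ s) :- (x :- s)) := (h :* :2) :* (s :* s′))
                     refl x s h (s ⁻¹) ⟩
        (h * 2#) * (s * s ⁻¹)
          ≈⟨ *-cong h*2≈1 s*s⁻¹≈1 ⟩
        1# * 1#
          ≈⟨ *-identityʳ 1# ⟩
        1# ∎

    -- The Binet forms in the shape K * (p₁ * r₁ ^ k + p₂ * r₂ ^ k) taken by weighted-binet.
    T[k] : ∀ k → T k x ≈ h * (1# * a ^ k + 1# * b ^ k)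
    T[k] k = trans (T-closed k) (*-congˡ (+-cong (sym (*-identityˡ _)) (sym (*-identityˡ _))))

    T[2k] : ∀ k → T (2 ℕ.* k) x ≈ h * (1# * (a * a) ^ k + 1# * (b * b) ^ k)
    T[2k] k = trans (T-closed (2 ℕ.* k))
      (*-congˡ (+-cong (trans (^-double a k) (sym (*-identityˡ _)))
                       (trans (^-double b k) (sym (*-identityˡ _)))))

    T[2k+1] : ∀ k → T (suc (2 ℕ.* k)) x ≈ h * (a * (a * a) ^ k + b * (b * b) ^ k)
    T[2k+1] k = trans (T-closed (suc (2 ℕ.* k)))
      (*-congˡ (+-cong (*-congˡ (^-double a k)) (*-congˡ (^-double b k))))

    U[k] : ∀ k → U k x ≈ (h * s ⁻¹) * (1# * a ^ suc k + (- 1#) * b ^ suc k)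
    U[k] k = trans (U-closed k) (*-congˡ (solve 2 (λ p q → p :- q := :1 :* p :+ (:- :1) :* q) refl _ _))

    U[2k] : ∀ k → U (2 ℕ.* k) x ≈ (h * s ⁻¹) * (a * (a * a) ^ k + (- b) * (b * b) ^ k)
    U[2k] k = trans (U-closed (2 ℕ.* k)) (*-congˡ (begin
      a * a ^ (2 ℕ.* k) − b * b ^ (2 ℕ.* k)
                                               ≈⟨ +-cong (*-congˡ (^-double a k)) (-‿cong (*-congˡ (^-double b k))) ⟩
      a * (a * a) ^ k − b * (b * b) ^ k        ≈⟨ solve 4 (λ a b p q → a :* p :- b :* q := a :* p :+ (:- b) :* q)
                                                          refl a b _ _ ⟩
      a * (a * a) ^ k + (- b) * (b * b) ^ k    ∎))

    U[2k+1] : ∀ k → U (2 ℕ.* suc k ∸ 1) x ≈ (h * s ⁻¹) * (1# * (a * a) ^ suc k + (- 1#) * (b * b) ^ suc k)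
    U[2k+1] k = begin
      U (2 ℕ.* suc k ∸ 1) x
        ≡⟨ ≡.cong (λ j → U (j ∸ 1) x) (2*suc k) ⟩
      U (suc (2 ℕ.* k)) x
        ≈⟨ U-closed (suc (2 ℕ.* k)) ⟩
      (h * s ⁻¹) * (a ^ suc (suc (2 ℕ.* k)) − b ^ suc (suc (2 ℕ.* k)))
        ≡⟨ ≡.cong (λ j → (h * s ⁻¹) * (a ^ j − b ^ j)) (2*suc k) ⟨
      (h * s ⁻¹) * (a ^ (2 ℕ.* suc k) − b ^ (2 ℕ.* suc k))
        ≈⟨ *-congˡ (+-cong (^-double a (suc k)) (-‿cong (^-double b (suc k)))) ⟩
      (h * s ⁻¹) * ((a * a) ^ suc k − (b * b) ^ suc k)
        ≈⟨ *-congˡ (solve 2 (λ p q → p :- q := :1 :* p :+ (:- :1) :* q) refl _ _) ⟩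
      (h * s ⁻¹) * (1# * (a * a) ^ suc k + (- 1#) * (b * b) ^ suc k) ∎

    A≈Ps⁻¹ : A ≈ P * s ⁻¹
    A≈Ps⁻¹ = trans (*-congˡ (⁻¹-distrib-* v≉0 s≉0)) (sym (*-assoc _ _ _))

    A^k : ∀ k → A ^ k ≈ (Q * s) * A ^ suc k
    A^k k = ^-shift k (begin
      (Q * s) * A               ≈⟨ *-congˡ A≈Ps⁻¹ ⟩
      (Q * s) * (P * s ⁻¹)      ≈⟨ solve 4 (λ Q s P s′ → (Q :* s) :* (P :* s′) := (Q :* P) :* (s :* s′))
                                           refl Q s P (s ⁻¹) ⟩
      (Q * P) * (s * s ⁻¹)      ≈⟨ *-cong QP≈1 s*s⁻¹≈1 ⟩
      1# * 1#                   ≈⟨ *-identityʳ 1# ⟩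
      1#                        ∎)

    hs⁻¹s≈h : (h * s ⁻¹) * s ≈ h
    hs⁻¹s≈h = trans (*-assoc _ _ _) (trans (*-congˡ (trans (*-comm _ _) s*s⁻¹≈1)) (*-identityʳ h))

    hs⁻¹D≈x : (h * s ⁻¹) * D ≈ x
    hs⁻¹D≈x = begin
      (h * s ⁻¹) * ((2# * x) * s)   ≈⟨ solve 4 (λ h s′ x s → (h :* s′) :* ((:2 :* x) :* s)
                                                         := (h :* :2) :* (s :* s′) :* x)
                                               refl h (s ⁻¹) x s ⟩
      (h * 2#) * (s * s ⁻¹) * x     ≈⟨ *-congʳ (*-cong h*2≈1 s*s⁻¹≈1) ⟩
      1# * 1# * x                   ≈⟨ trans (*-congʳ (*-identityʳ 1#)) (*-identityˡ x) ⟩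
      x                             ∎

    hs⁻¹Qs≈hQ : (h * s ⁻¹) * (Q * s) ≈ h * Q
    hs⁻¹Qs≈hQ = begin
      (h * s ⁻¹) * (Q * s)   ≈⟨ solve 4 (λ h s′ Q s → (h :* s′) :* (Q :* s) := (h :* Q) :* (s :* s′))
                                        refl h (s ⁻¹) Q s ⟩
      (h * Q) * (s * s ⁻¹)   ≈⟨ *-congˡ s*s⁻¹≈1 ⟩
      (h * Q) * 1#           ≈⟨ *-identityʳ _ ⟩
      h * Q                  ∎

    tail-1+ : ∀ σ → 1# + σ ≈ 1# + σ * 1#
    tail-1+ σ = +-congˡ (sym (*-identityʳ σ))

    tail-1− : ∀ σ → 1# − σ ≈ 1# + σ * (- 1#)
    tail-1− σ = +-congˡ (solve 1 (λ σ → :- σ := σ :* (:- :1)) refl σ)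

    tail-ω+ : ∀ σ → ω x s + σ * (ω x s) ⁻¹ ≈ a + σ * b
    tail-ω+ σ = +-congˡ (*-congˡ ω⁻¹≈b)

    tail-ω− : ∀ σ → ω x s − σ * (ω x s) ⁻¹ ≈ a + σ * (- b)
    tail-ω− σ = +-congˡ (trans (-‿cong (*-congˡ ω⁻¹≈b)) (solve 2 (λ σ b → :- (σ :* b) := σ :* (:- b))
                                                                 refl σ b))

    s-relation : a * s ⁻¹ − 1# ≈ b * s ⁻¹ + 1#
    s-relation = ratio-shift s≉0 (solve 2 (λ x s → (x :+ s) :- s := (x :- s) :+ s) refl x s)

    D-relation : (a * a) * D ⁻¹ − 1# ≈ (b * b) * D ⁻¹ + 1#
    D-relation = ratio-shift D≉0
      (solve 2 (λ x s → (x :+ s) :* (x :+ s) :- :2 :* x :* s := (x :- s) :* (x :- s) :+ :2 :* x :* s)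
               refl x s)

    modulo-s² : ∀ {L R c} → L ≈ R + c * (s * s − (x * x − 1#)) → L ≈ R
    modulo-s² {L} {R} {c} L≈ = begin
      L                                   ≈⟨ L≈ ⟩
      R + c * (s * s − (x * x − 1#))      ≈⟨ +-congˡ (*-congˡ (x≈y⇒x∙y⁻¹≈ε s²)) ⟩
      R + c * 0#                          ≈⟨ +-congˡ (zeroʳ c) ⟩
      R + 0#                              ≈⟨ +-identityʳ R ⟩
      R                                   ∎

    A-B-relation : ∀ {ρ δ ρ′ δ′} → ρ * u + δ * (v * s) ≈ (ρ′ * ρ′) * x + δ′ * (u * s) →
                   ρ * A + δ ≈ P * ((ρ′ * ρ′) * B + δ′)
    A-B-relation {ρ} {δ} {ρ′} {δ′} cleared = *-cancelˡ (*-≉0 v≉0 s≉0) (begin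
      (v * s) * (ρ * A + δ)
        ≈⟨ solve 4 (λ V ρ A δ → V :* (ρ :* A :+ δ) := ρ :* (V :* A) :+ δ :* V) refl (v * s) ρ A δ ⟩
      ρ * ((v * s) * A) + δ * (v * s)
        ≈⟨ +-congʳ (*-congˡ (*-⁻¹-cancel u (*-≉0 v≉0 s≉0))) ⟩
      ρ * u + δ * (v * s)
        ≈⟨ cleared ⟩
      (ρ′ * ρ′) * x + δ′ * (u * s)
        ≈⟨ +-congʳ (*-congˡ (*-⁻¹-cancel x (*-≉0 u≉0 s≉0))) ⟨
      (ρ′ * ρ′) * ((u * s) * B) + δ′ * (u * s)
        ≈⟨ solve 5 (λ u s R B δ′ → R :* ((u :* s) :* B) :+ δ′ :* (u :* s) := u :* (s :* (R :* B) :+ s :* δ′))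
                   refl u s (ρ′ * ρ′) B δ′ ⟩
      u * (s * ((ρ′ * ρ′) * B) + s * δ′)
        ≈⟨ *-congʳ (*-⁻¹-cancel u v≉0) ⟨
      (v * P) * (s * ((ρ′ * ρ′) * B) + s * δ′)
        ≈⟨ solve 5 (λ v s P R δ′ → (v :* P) :* (s :* R :+ s :* δ′) := (v :* s) :* (P :* (R :+ δ′)))
                   refl v s P ((ρ′ * ρ′) * B) δ′ ⟩
      (v * s) * (P * ((ρ′ * ρ′) * B + δ′)) ∎)

    :u :v : ∀ {j} → Polynomial j → Polynomial j
    :u x = :2 :* (x :* x) :- :1
    :v x = :2 :* (x :* x)

    :s²-defect : ∀ {j} → Polynomial j → Polynomial j → Polynomial j
    :s²-defect x s = s :* s :- (x :* x :- :1)

    aA+1≈P[a²B+1] : a * A + 1# ≈ P * ((a * a) * B + 1#)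
    aA+1≈P[a²B+1] = A-B-relation (modulo-s² (solve 2 (λ x s →
      (x :+ s) :* :u x :+ :1 :* (:v x :* s)
        := ((x :+ s) :* (x :+ s)) :* x :+ :1 :* (:u x :* s)
             :+ (:- x) :* :s²-defect x s) refl x s))

    aA−1≈P[b²B+1] : a * A − 1# ≈ P * ((b * b) * B + 1#)
    aA−1≈P[b²B+1] = A-B-relation (modulo-s² (solve 2 (λ x s →
      (x :+ s) :* :u x :+ (:- :1) :* (:v x :* s)
        := ((x :- s) :* (x :- s)) :* x :+ :1 :* (:u x :* s)
             :+ (:- x) :* :s²-defect x s) refl x s))

    bA+1≈P[a²B−1] : b * A + 1# ≈ P * ((a * a) * B − 1#)
    bA+1≈P[a²B−1] = A-B-relation (modulo-s² (solve 2 (λ x s →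
      (x :- s) :* :u x :+ :1 :* (:v x :* s)
        := ((x :+ s) :* (x :+ s)) :* x :+ (:- :1) :* (:u x :* s)
             :+ (:- x) :* :s²-defect x s) refl x s))

    bA−1≈P[b²B−1] : b * A − 1# ≈ P * ((b * b) * B − 1#)
    bA−1≈P[b²B−1] = A-B-relation (modulo-s² (solve 2 (λ x s →
      (x :- s) :* :u x :+ (:- :1) :* (:v x :* s)
        := ((x :- s) :* (x :- s)) :* x :+ (:- :1) :* (:u x :* s)
             :+ (:- x) :* :s²-defect x s) refl x s))

    module Identities (m : ℕ) where

      -- With n = m + 1, P ^ n unfolds to P * P ^ (n ∸ 1), as identities 4 and 5 need.
      n : ℕ
      n = suc m

      open TwistedPair n

      Φ⁺ Φ⁻ : Carrier → Carrier
      Φ⁺ q = (q + 1#) ^ n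
      Φ⁻ q = (q − 1#) ^ n

      opposite-sum : ∀ K → K * 1# + K * (- 1#) ≈ 0#
      opposite-sum = solve 1 (λ K → K :* :1 :+ K :* (:- :1) := :0) refl

      a′ b′ : Carrier
      a′ = a * s ⁻¹
      b′ = b * s ⁻¹

      α₂ β₂ αA βA αB βB : Carrier
      α₂ = (a * a) * D ⁻¹
      β₂ = (b * b) * D ⁻¹
      αA = a * A
      βA = b * A
      αB = (a * a) * B
      βB = (b * b) * B

      s-fold : ∀ {K₁ K₂ α β} → pairForm K₁ K₂ α β (Φ⁺ a′) (Φ⁻ a′) (Φ⁺ b′) (Φ⁻ b′)
                             ≈ pairForm K₁ K₂ α β (Φ⁺ a′) (Φ⁺ b′) (Φ⁺ b′) (Φ⁻ b′)
      s-fold = pairForm-cong refl (^-congˡ n s-relation) refl refl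

      D-fold : ∀ {K₁ K₂ α β} → pairForm K₁ K₂ α β (Φ⁺ α₂) (Φ⁻ α₂) (Φ⁺ β₂) (Φ⁻ β₂)
                             ≈ pairForm K₁ K₂ α β (Φ⁺ α₂) (Φ⁺ β₂) (Φ⁺ β₂) (Φ⁻ β₂)
      D-fold = pairForm-cong refl (^-congˡ n D-relation) refl refl

      A-to-B : ∀ {K₁ K₂ α β} → pairForm K₁ K₂ α β (Φ⁺ αA) (Φ⁻ αA) (Φ⁺ βA) (Φ⁻ βA)
               ≈ pairForm K₁ K₂ α β (P ^ n * Φ⁺ αB) (P ^ n * Φ⁺ βB) (P ^ n * Φ⁻ αB) (P ^ n * Φ⁻ βB)
      A-to-B = pairForm-cong (scaled aA+1≈P[a²B+1]) (scaled aA−1≈P[b²B+1])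
                             (scaled bA+1≈P[a²B−1]) (scaled bA−1≈P[b²B−1])
        where
        scaled : ∀ {y z} → y ≈ P * z → y ^ n ≈ P ^ n * z ^ n
        scaled {y} {z} y≈Pz = trans (^-congˡ n y≈Pz) (^-distrib-* P z n)

      QⁿPⁿ≈1 : Q ^ n * P ^ n ≈ 1#
      QⁿPⁿ≈1 = trans (sym (^-distrib-* Q P n)) (trans (^-congˡ n QP≈1) (1^ n))

      identity₁ : Σ[ 1 to n ] (λ k → binom n k * U (k ∸ 1) x * ((s ^ (k ∸ 1)) ⁻¹) * (1# + sgn (n ∸ k)))
                ≈ Σ[ 0 to n ] (λ k → binom n k * T k x * ((s ^ k) ⁻¹) * (1# − sgn (n ∸ k)))
      identity₁ = begin
        _ ≈⟨ twisted-pair-sum₁ {X = λ k → U (k ∸ 1) x} {Y = λ k → (s ^ (k ∸ 1)) ⁻¹}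
               (λ k → weighted-binet (suc k) (U[k] k) (^-⁻¹-shifted k s≉0) hs⁻¹s≈h)
               (λ _ → tail-1+ _) (opposite-sum h) ⟩
        pairForm (h * 1#) (h * - 1#) 1# 1# (Φ⁺ a′) (Φ⁻ a′) (Φ⁺ b′) (Φ⁻ b′)
          ≈⟨ s-fold ⟩
        pairForm (h * 1#) (h * - 1#) 1# 1# (Φ⁺ a′) (Φ⁺ b′) (Φ⁺ b′) (Φ⁻ b′)
          ≈⟨ solve 4 (λ h p p′ m′ → :pairForm (h :* :1) (h :* (:- :1)) :1 :1 p p′ p′ m′
                                  := :pairForm (h :* :1) (h :* :1) :1 (:- :1) p p′ p′ m′)
                     refl h _ _ _ ⟩
        pairForm (h * 1#) (h * 1#) 1# (- 1#) (Φ⁺ a′) (Φ⁺ b′) (Φ⁺ b′) (Φ⁻ b′)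
          ≈⟨ s-fold ⟨
        pairForm (h * 1#) (h * 1#) 1# (- 1#) (Φ⁺ a′) (Φ⁻ a′) (Φ⁺ b′) (Φ⁻ b′)
          ≈⟨ twisted-pair-sum (λ k → weighted-binet k (T[k] k) (^-⁻¹-scaled k s≉0) (*-identityʳ h))
                              (λ _ → tail-1− _) ⟨
        _ ∎

      identity₂ : Σ[ 0 to n ] (λ k → binom n k * U (2 ℕ.* k) x * (D * ((D ^ k) ⁻¹))
                                     * (ω x s + sgn (n ∸ k) * (ω x s) ⁻¹))
                ≈ (2# * x) * Σ[ 0 to n ] (λ k → binom n k * T (suc (2 ℕ.* k)) x * ((D ^ k) ⁻¹)
                                                 * (ω x s − sgn (n ∸ k) * (ω x s) ⁻¹))
      identity₂ = begin
        _ ≈⟨ twisted-pair-sum (λ k → weighted-binet k (U[2k] k) (*-congˡ (^-⁻¹ k D*D⁻¹≈1)) hs⁻¹D≈x)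
                              (λ _ → tail-ω+ _) ⟩
        pairForm (x * a) (x * - b) a b (Φ⁺ α₂) (Φ⁻ α₂) (Φ⁺ β₂) (Φ⁻ β₂)
          ≈⟨ D-fold ⟩
        pairForm (x * a) (x * - b) a b (Φ⁺ α₂) (Φ⁺ β₂) (Φ⁺ β₂) (Φ⁻ β₂)
          ≈⟨ drop-unit h*2≈1 (solve 7 (λ x a b h p p′ m′ →
               :2 :* x :* :pairForm (h :* a) (h :* b) a (:- b) p p′ p′ m′
                 := (h :* :2) :* :pairForm (x :* a) (x :* (:- b)) a b p p′ p′ m′)
               refl x a b h _ _ _) ⟨
        (2# * x) * pairForm (h * a) (h * b) a (- b) (Φ⁺ α₂) (Φ⁺ β₂) (Φ⁺ β₂) (Φ⁻ β₂)
          ≈⟨ *-congˡ D-fold ⟨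
        (2# * x) * pairForm (h * a) (h * b) a (- b) (Φ⁺ α₂) (Φ⁻ α₂) (Φ⁺ β₂) (Φ⁻ β₂)
          ≈⟨ *-congˡ (twisted-pair-sum (λ k → weighted-binet k (T[2k+1] k) (^-⁻¹-scaled k D≉0) (*-identityʳ h))
                                       (λ _ → tail-ω− _)) ⟨
        _ ∎

      identity₃ : s * Σ[ 1 to n ] (λ k → binom n k * U (2 ℕ.* k ∸ 1) x * ((D ^ k) ⁻¹) * (1# + sgn (n ∸ k)))
                ≈ Σ[ 0 to n ] (λ k → binom n k * T (2 ℕ.* k) x * ((D ^ k) ⁻¹) * (1# − sgn (n ∸ k)))
      identity₃ = begin
        _ ≈⟨ *-congˡ (twisted-pair-sum₁ {X = λ k → U (2 ℕ.* k ∸ 1) x} {Y = λ k → (D ^ k) ⁻¹}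
               (λ k → weighted-binet (suc k) (U[2k+1] k) (^-⁻¹-scaled (suc k) D≉0) (*-identityʳ _))
               (λ _ → tail-1+ _) (opposite-sum _)) ⟩
        s * pairForm ((h * s ⁻¹) * 1#) ((h * s ⁻¹) * - 1#) 1# 1# (Φ⁺ α₂) (Φ⁻ α₂) (Φ⁺ β₂) (Φ⁻ β₂)
          ≈⟨ *-congˡ D-fold ⟩
        s * pairForm ((h * s ⁻¹) * 1#) ((h * s ⁻¹) * - 1#) 1# 1# (Φ⁺ α₂) (Φ⁺ β₂) (Φ⁺ β₂) (Φ⁻ β₂)
          ≈⟨ drop-unit s*s⁻¹≈1 (solve 6 (λ s s′ h p p′ m′ →
               s :* :pairForm ((h :* s′) :* :1) ((h :* s′) :* (:- :1)) :1 :1 p p′ p′ m′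
                 := (s :* s′) :* :pairForm (h :* :1) (h :* :1) :1 (:- :1) p p′ p′ m′)
               refl s (s ⁻¹) h _ _ _) ⟩
        pairForm (h * 1#) (h * 1#) 1# (- 1#) (Φ⁺ α₂) (Φ⁺ β₂) (Φ⁺ β₂) (Φ⁻ β₂)
          ≈⟨ D-fold ⟨
        pairForm (h * 1#) (h * 1#) 1# (- 1#) (Φ⁺ α₂) (Φ⁻ α₂) (Φ⁺ β₂) (Φ⁻ β₂)
          ≈⟨ twisted-pair-sum (λ k → weighted-binet k (T[2k] k) (^-⁻¹-scaled k D≉0) (*-identityʳ h))
                              (λ _ → tail-1− _) ⟨
        _ ∎

      identity₄ : Σ[ 1 to n ] (λ k → binom n k * U (k ∸ 1) x * (A ^ (k ∸ 1))
                                     * (ω x s + sgn (n ∸ k) * (ω x s) ⁻¹))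
                ≈ (P ^ (n ∸ 1)) * Σ[ 0 to n ] (λ k → binom n k * T (suc (2 ℕ.* k)) x * (B ^ k)
                                                     * (1# − sgn (n ∸ k)))
      identity₄ = begin
        _ ≈⟨ twisted-pair-sum₁ {X = λ k → U (k ∸ 1) x} {Y = λ k → A ^ (k ∸ 1)}
               (λ k → weighted-binet (suc k) (U[k] k) (A^k k) hs⁻¹Qs≈hQ)
               (λ _ → tail-ω+ _) (opposite-sum _) ⟩
        pairForm ((h * Q) * 1#) ((h * Q) * - 1#) a b (Φ⁺ αA) (Φ⁻ αA) (Φ⁺ βA) (Φ⁻ βA)
          ≈⟨ A-to-B ⟩
        pairForm ((h * Q) * 1#) ((h * Q) * - 1#) a b
                 (P ^ n * Φ⁺ αB) (P ^ n * Φ⁺ βB) (P ^ n * Φ⁻ αB) (P ^ n * Φ⁻ βB)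
          ≈⟨ drop-unit QP≈1 (solve 10 (λ h Q P Pᵐ a b p m p′ m′ →
               :pairForm ((h :* Q) :* :1) ((h :* Q) :* (:- :1)) a b
                         (P :* Pᵐ :* p) (P :* Pᵐ :* p′) (P :* Pᵐ :* m) (P :* Pᵐ :* m′)
                 := (Q :* P) :* (Pᵐ :* :pairForm (h :* a) (h :* b) :1 (:- :1) p m p′ m′))
               refl h Q P (P ^ m) a b _ _ _ _) ⟩
        P ^ m * pairForm (h * a) (h * b) 1# (- 1#) (Φ⁺ αB) (Φ⁻ αB) (Φ⁺ βB) (Φ⁻ βB)
          ≈⟨ *-congˡ (twisted-pair-sum (λ k → weighted-binet k (T[2k+1] k) (sym (*-identityˡ _)) (*-identityʳ h))
                                       (λ _ → tail-1− _)) ⟨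
        _ ∎

      identity₅ : Σ[ 1 to n ] (λ k → binom n k * U (k ∸ 1) x * (A ^ (k ∸ 1)) * (1# + sgn (n ∸ k)))
                ≈ (P ^ (n ∸ 1)) * Σ[ 0 to n ] (λ k → binom n k * T (2 ℕ.* k) x * (B ^ k) * (1# − sgn (n ∸ k)))
      identity₅ = begin
        _ ≈⟨ twisted-pair-sum₁ {X = λ k → U (k ∸ 1) x} {Y = λ k → A ^ (k ∸ 1)}
               (λ k → weighted-binet (suc k) (U[k] k) (A^k k) hs⁻¹Qs≈hQ)
               (λ _ → tail-1+ _) (opposite-sum _) ⟩
        pairForm ((h * Q) * 1#) ((h * Q) * - 1#) 1# 1# (Φ⁺ αA) (Φ⁻ αA) (Φ⁺ βA) (Φ⁻ βA)
          ≈⟨ A-to-B ⟩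
        pairForm ((h * Q) * 1#) ((h * Q) * - 1#) 1# 1#
                 (P ^ n * Φ⁺ αB) (P ^ n * Φ⁺ βB) (P ^ n * Φ⁻ αB) (P ^ n * Φ⁻ βB)
          ≈⟨ drop-unit QP≈1 (solve 8 (λ h Q P Pᵐ p m p′ m′ →
               :pairForm ((h :* Q) :* :1) ((h :* Q) :* (:- :1)) :1 :1
                         (P :* Pᵐ :* p) (P :* Pᵐ :* p′) (P :* Pᵐ :* m) (P :* Pᵐ :* m′)
                 := (Q :* P) :* (Pᵐ :* :pairForm (h :* :1) (h :* :1) :1 (:- :1) p m p′ m′))
               refl h Q P (P ^ m) _ _ _ _) ⟩
        P ^ m * pairForm (h * 1#) (h * 1#) 1# (- 1#) (Φ⁺ αB) (Φ⁻ αB) (Φ⁺ βB) (Φ⁻ βB)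
          ≈⟨ *-congˡ (twisted-pair-sum (λ k → weighted-binet k (T[2k] k) (sym (*-identityˡ _)) (*-identityʳ h))
                                       (λ _ → tail-1− _)) ⟨
        _ ∎

      identity₆ : s * Σ[ 0 to n ] (λ k → binom n k * U (2 ℕ.* k) x * (B ^ k) * (1# + sgn (n ∸ k)))
                ≈ (Q ^ n) * Σ[ 0 to n ] (λ k → binom n k * T k x * (A ^ k)
                                               * (ω x s − sgn (n ∸ k) * (ω x s) ⁻¹))
      identity₆ = begin
        _ ≈⟨ *-congˡ (twisted-pair-sum (λ k → weighted-binet k (U[2k] k) (sym (*-identityˡ _)) (*-identityʳ _))
                                       (λ _ → tail-1+ _)) ⟩
        s * pairForm ((h * s ⁻¹) * a) ((h * s ⁻¹) * - b) 1# 1# (Φ⁺ αB) (Φ⁻ αB) (Φ⁺ βB) (Φ⁻ βB)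
          ≈⟨ drop-unit s*s⁻¹≈1 (solve 9 (λ s s′ h a b p m p′ m′ →
               s :* :pairForm ((h :* s′) :* a) ((h :* s′) :* (:- b)) :1 :1 p m p′ m′
                 := (s :* s′) :* :pairForm (h :* a) (h :* (:- b)) :1 :1 p m p′ m′)
               refl s (s ⁻¹) h a b _ _ _ _) ⟩
        pairForm (h * a) (h * - b) 1# 1# (Φ⁺ αB) (Φ⁻ αB) (Φ⁺ βB) (Φ⁻ βB)
          ≈⟨ drop-unit QⁿPⁿ≈1 (solve 9 (λ Qⁿ Pⁿ h a b p m p′ m′ →
               Qⁿ :* :pairForm (h :* :1) (h :* :1) a (:- b) (Pⁿ :* p) (Pⁿ :* p′) (Pⁿ :* m) (Pⁿ :* m′)
                 := (Qⁿ :* Pⁿ) :* :pairForm (h :* a) (h :* (:- b)) :1 :1 p m p′ m′)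
               refl (Q ^ n) (P ^ n) h a b _ _ _ _) ⟨
        Q ^ n * pairForm (h * 1#) (h * 1#) a (- b)
                         (P ^ n * Φ⁺ αB) (P ^ n * Φ⁺ βB) (P ^ n * Φ⁻ αB) (P ^ n * Φ⁻ βB)
          ≈⟨ *-congˡ A-to-B ⟨
        Q ^ n * pairForm (h * 1#) (h * 1#) a (- b) (Φ⁺ αA) (Φ⁻ αA) (Φ⁺ βA) (Φ⁻ βA)
          ≈⟨ *-congˡ (twisted-pair-sum (λ k → weighted-binet k (T[k] k) (sym (*-identityˡ _)) (*-identityʳ h))
                                       (λ _ → tail-ω− _)) ⟨
        _ ∎

      identity₇ : s * Σ[ 0 to n ] (λ k → binom n k * U (2 ℕ.* k) x * ((D ^ k) ⁻¹) * (1# + sgn (n ∸ k)))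
                ≈ Σ[ 0 to n ] (λ k → binom n k * T (2 ℕ.* k) x * ((D ^ k) ⁻¹)
                                     * (ω x s − sgn (n ∸ k) * (ω x s) ⁻¹))
      identity₇ = begin
        _ ≈⟨ *-congˡ (twisted-pair-sum (λ k → weighted-binet k (U[2k] k) (^-⁻¹-scaled k D≉0) (*-identityʳ _))
                                       (λ _ → tail-1+ _)) ⟩
        s * pairForm ((h * s ⁻¹) * a) ((h * s ⁻¹) * - b) 1# 1# (Φ⁺ α₂) (Φ⁻ α₂) (Φ⁺ β₂) (Φ⁻ β₂)
          ≈⟨ *-congˡ D-fold ⟩
        s * pairForm ((h * s ⁻¹) * a) ((h * s ⁻¹) * - b) 1# 1# (Φ⁺ α₂) (Φ⁺ β₂) (Φ⁺ β₂) (Φ⁻ β₂)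
          ≈⟨ drop-unit s*s⁻¹≈1 (solve 8 (λ s s′ h a b p p′ m′ →
               s :* :pairForm ((h :* s′) :* a) ((h :* s′) :* (:- b)) :1 :1 p p′ p′ m′
                 := (s :* s′) :* :pairForm (h :* :1) (h :* :1) a (:- b) p p′ p′ m′)
               refl s (s ⁻¹) h a b _ _ _) ⟩
        pairForm (h * 1#) (h * 1#) a (- b) (Φ⁺ α₂) (Φ⁺ β₂) (Φ⁺ β₂) (Φ⁻ β₂)
          ≈⟨ D-fold ⟨
        pairForm (h * 1#) (h * 1#) a (- b) (Φ⁺ α₂) (Φ⁻ α₂) (Φ⁺ β₂) (Φ⁻ β₂)
          ≈⟨ twisted-pair-sum (λ k → weighted-binet k (T[2k] k) (^-⁻¹-scaled k D≉0) (*-identityʳ h))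
                              (λ _ → tail-ω− _) ⟨
        _ ∎

      identity₈ : s * Σ[ 1 to n ] (λ k → binom n k * U (2 ℕ.* k ∸ 1) x * (B ^ k) * (1# + sgn (n ∸ k)))
                ≈ (Q ^ n) * Σ[ 0 to n ] (λ k → binom n k * T k x * (A ^ k) * (1# − sgn (n ∸ k)))
      identity₈ = begin
        _ ≈⟨ *-congˡ (twisted-pair-sum₁ {X = λ k → U (2 ℕ.* k ∸ 1) x} {Y = λ k → B ^ k}
               (λ k → weighted-binet (suc k) (U[2k+1] k) (sym (*-identityˡ _)) (*-identityʳ _))
               (λ _ → tail-1+ _) (opposite-sum _)) ⟩
        s * pairForm ((h * s ⁻¹) * 1#) ((h * s ⁻¹) * - 1#) 1# 1# (Φ⁺ αB) (Φ⁻ αB) (Φ⁺ βB) (Φ⁻ βB)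
          ≈⟨ drop-unit s*s⁻¹≈1 (solve 7 (λ s s′ h p m p′ m′ →
               s :* :pairForm ((h :* s′) :* :1) ((h :* s′) :* (:- :1)) :1 :1 p m p′ m′
                 := (s :* s′) :* :pairForm (h :* :1) (h :* (:- :1)) :1 :1 p m p′ m′)
               refl s (s ⁻¹) h _ _ _ _) ⟩
        pairForm (h * 1#) (h * - 1#) 1# 1# (Φ⁺ αB) (Φ⁻ αB) (Φ⁺ βB) (Φ⁻ βB)
          ≈⟨ drop-unit QⁿPⁿ≈1 (solve 7 (λ Qⁿ Pⁿ h p m p′ m′ →
               Qⁿ :* :pairForm (h :* :1) (h :* :1) :1 (:- :1) (Pⁿ :* p) (Pⁿ :* p′) (Pⁿ :* m) (Pⁿ :* m′)
                 := (Qⁿ :* Pⁿ) :* :pairForm (h :* :1) (h :* (:- :1)) :1 :1 p m p′ m′)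
               refl (Q ^ n) (P ^ n) h _ _ _ _) ⟨
        Q ^ n * pairForm (h * 1#) (h * 1#) 1# (- 1#)
                         (P ^ n * Φ⁺ αB) (P ^ n * Φ⁺ βB) (P ^ n * Φ⁻ αB) (P ^ n * Φ⁻ βB)
          ≈⟨ *-congˡ A-to-B ⟨
        Q ^ n * pairForm (h * 1#) (h * 1#) 1# (- 1#) (Φ⁺ αA) (Φ⁻ αA) (Φ⁺ βA) (Φ⁻ βA)
          ≈⟨ *-congˡ (twisted-pair-sum (λ k → weighted-binet k (T[k] k) (sym (*-identityˡ _)) (*-identityʳ h))
                                       (λ _ → tail-1− _)) ⟨
        _ ∎

      identity₉ : Σ[ 1 to n ] (λ k → binom n k * U (2 ℕ.* k ∸ 1) x * ((D ^ (k ∸ 1)) ⁻¹)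
                                     * (ω x s + sgn (n ∸ k) * (ω x s) ⁻¹))
                ≈ (2# * x) * Σ[ 0 to n ] (λ k → binom n k * T (suc (2 ℕ.* k)) x * ((D ^ k) ⁻¹)
                                                 * (1# − sgn (n ∸ k)))
      identity₉ = begin
        _ ≈⟨ twisted-pair-sum₁ {X = λ k → U (2 ℕ.* k ∸ 1) x} {Y = λ k → (D ^ (k ∸ 1)) ⁻¹}
               (λ k → weighted-binet (suc k) (U[2k+1] k) (^-⁻¹-shifted k D≉0) hs⁻¹D≈x)
               (λ _ → tail-ω+ _) (opposite-sum x) ⟩
        pairForm (x * 1#) (x * - 1#) a b (Φ⁺ α₂) (Φ⁻ α₂) (Φ⁺ β₂) (Φ⁻ β₂)
          ≈⟨ D-fold ⟩
        pairForm (x * 1#) (x * - 1#) a b (Φ⁺ α₂) (Φ⁺ β₂) (Φ⁺ β₂) (Φ⁻ β₂)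
          ≈⟨ drop-unit h*2≈1 (solve 7 (λ x a b h p p′ m′ →
               :2 :* x :* :pairForm (h :* a) (h :* b) :1 (:- :1) p p′ p′ m′
                 := (h :* :2) :* :pairForm (x :* :1) (x :* (:- :1)) a b p p′ p′ m′)
               refl x a b h _ _ _) ⟨
        (2# * x) * pairForm (h * a) (h * b) 1# (- 1#) (Φ⁺ α₂) (Φ⁺ β₂) (Φ⁺ β₂) (Φ⁻ β₂)
          ≈⟨ *-congˡ D-fold ⟨
        (2# * x) * pairForm (h * a) (h * b) 1# (- 1#) (Φ⁺ α₂) (Φ⁻ α₂) (Φ⁺ β₂) (Φ⁻ β₂)
          ≈⟨ *-congˡ (twisted-pair-sum (λ k → weighted-binet k (T[2k+1] k) (^-⁻¹-scaled k D≉0) (*-identityʳ h))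
                                       (λ _ → tail-1− _)) ⟨
        _ ∎

corollary9 : ∀ {c ℓ} (F : Field c ℓ) →
  let open Field F
      open Cheb F
  in (x s : Carrier) →
     ¬ (x ≈ 0#) → ¬ ((x * x) ≈ 1#) → ¬ ((2# * (x * x)) ≈ 1#) →
     (s * s) ≈ ((x * x) − 1#) →
     (n : ℕ) → 1 ≤ n →
     let w  = ω x s
         wi = (ω x s) ⁻¹
         D  = (2# * x) * s
         A  = ((2# * (x * x)) − 1#) * (((2# * (x * x)) * s) ⁻¹)
         B  = x * ((((2# * (x * x)) − 1#) * s) ⁻¹)
         P  = ((2# * (x * x)) − 1#) * ((2# * (x * x)) ⁻¹)
         Q  = (2# * (x * x)) * (((2# * (x * x)) − 1#) ⁻¹)
     in
     -- (1)
     (Σ[ 1 to n ] (λ k → binom n k * U (k ∸ 1) x * ((s ^ (k ∸ 1)) ⁻¹)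
                         * (1# + sgn (n ∸ k)))
       ≈ Σ[ 0 to n ] (λ k → binom n k * T k x * ((s ^ k) ⁻¹)
                         * (1# − sgn (n ∸ k))))
     ×
     -- (2)   (the factor 1/D^(k-1) is written D * (D^k)⁻¹, also for k = 0)
     (Σ[ 0 to n ] (λ k → binom n k * U (2 ℕ.* k) x * (D * ((D ^ k) ⁻¹))
                         * (w + sgn (n ∸ k) * wi))
       ≈ (2# * x) * Σ[ 0 to n ] (λ k → binom n k * T (suc (2 ℕ.* k)) x
                         * ((D ^ k) ⁻¹) * (w − sgn (n ∸ k) * wi)))
     ×
     -- (3)
     (s * Σ[ 1 to n ] (λ k → binom n k * U (2 ℕ.* k ∸ 1) x * ((D ^ k) ⁻¹)
                         * (1# + sgn (n ∸ k)))
       ≈ Σ[ 0 to n ] (λ k → binom n k * T (2 ℕ.* k) x * ((D ^ k) ⁻¹)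
                         * (1# − sgn (n ∸ k))))
     ×
     -- (4)
     (Σ[ 1 to n ] (λ k → binom n k * U (k ∸ 1) x * (A ^ (k ∸ 1))
                         * (w + sgn (n ∸ k) * wi))
       ≈ (P ^ (n ∸ 1)) * Σ[ 0 to n ] (λ k → binom n k * T (suc (2 ℕ.* k)) x
                         * (B ^ k) * (1# − sgn (n ∸ k))))
     ×
     -- (5)
     (Σ[ 1 to n ] (λ k → binom n k * U (k ∸ 1) x * (A ^ (k ∸ 1))
                         * (1# + sgn (n ∸ k)))
       ≈ (P ^ (n ∸ 1)) * Σ[ 0 to n ] (λ k → binom n k * T (2 ℕ.* k) x
                         * (B ^ k) * (1# − sgn (n ∸ k))))
     ×
     -- (6)
     (s * Σ[ 0 to n ] (λ k → binom n k * U (2 ℕ.* k) x * (B ^ k)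
                         * (1# + sgn (n ∸ k)))
       ≈ (Q ^ n) * Σ[ 0 to n ] (λ k → binom n k * T k x
                         * (A ^ k) * (w − sgn (n ∸ k) * wi)))
     ×
     -- (7)
     (s * Σ[ 0 to n ] (λ k → binom n k * U (2 ℕ.* k) x * ((D ^ k) ⁻¹)
                         * (1# + sgn (n ∸ k)))
       ≈ Σ[ 0 to n ] (λ k → binom n k * T (2 ℕ.* k) x * ((D ^ k) ⁻¹)
                         * (w − sgn (n ∸ k) * wi)))
     ×
     -- (8)
     (s * Σ[ 1 to n ] (λ k → binom n k * U (2 ℕ.* k ∸ 1) x * (B ^ k)
                         * (1# + sgn (n ∸ k)))
       ≈ (Q ^ n) * Σ[ 0 to n ] (λ k → binom n k * T k x
                         * (A ^ k) * (1# − sgn (n ∸ k))))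
     ×
     -- (9)
     (Σ[ 1 to n ] (λ k → binom n k * U (2 ℕ.* k ∸ 1) x * ((D ^ (k ∸ 1)) ⁻¹)
                         * (w + sgn (n ∸ k) * wi))
       ≈ (2# * x) * Σ[ 0 to n ] (λ k → binom n k * T (suc (2 ℕ.* k)) x
                         * ((D ^ k) ⁻¹) * (1# − sgn (n ∸ k))))
corollary9 F x s x≉0 x²≉1 2x²≉1 s² zero    ()
corollary9 F x s x≉0 x²≉1 2x²≉1 s² (suc m) _ =
  identity₁ , identity₂ , identity₃ , identity₄ , identity₅ , identity₆ , identity₇ , identity₈ , identity₉
  where
  open AtPoint F x s x≉0 x²≉1 2x²≉1 s²
  open Identities m
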